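{- Let $G$ be a quasi-tree graph of order $n$ with $3\leq n\leq 6$, and suppose $G$ is isomorphic to neither $U_{6,4}^{1,1}$ nor $U_{5,3}^{1,1}$. Then $$H(G)\geq D(G)+\frac{5}{3}-\frac{n}{2}\qquad\text{and}\qquad H(G)\geq \left(\frac{1}{2} +\frac{2}{3(n-2)}\right)D(G).$$
   Context: All graphs are finite, simple, undirected and connected. For a graph $G$ and a vertex $u$, $d_u$ denotes the degree of $u$ in $G$. The harmonic index of $G$ is $H(G)=\sum_{uv\in E(G)}\frac{2}{d_u+d_v}$. $D(G)$ denotes the diameter of $G$ (the maximum distance between two vertices). A graph $G$ is a quasi-tree graph if $G$ is connected, $G$ is not a tree, and there exists a vertex $v\in V(G)$ such that $G-v$ is a tree. $U_{6,4}^{1,1}$ is the graph of order $6$ obtained from the $4$-cycle $C_4$ by attaching one pendant vertex to a vertex $a$ of the cycle and one pendant vertex to the vertex of the cycle not adjacent to $a$. $U_{5,3}^{1,1}$ is the graph of order $5$ obtained from the triangle $K_3$ by attaching one pendant vertex to each of two distinct vertices of the triangle. -}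

module Defs where

open import Data.Bool using (Bool; true; false; _∧_; _∨_; if_then_else_)
open import Data.Bool.Properties using (∨-comm)
open import Data.Nat using (ℕ; zero; suc; _+_; _≡ᵇ_; _<ᵇ_; _≤_)
open import Data.Fin using (Fin; zero; suc; toℕ; punchIn; inject₁; fromℕ)
open import Data.List using (List; []; _∷_; foldr; allFin)
open import Data.Bool.ListAction using (any)
open import Data.Product using (Σ; _×_; _,_; ∃)
open import Data.Integer using (+_)
open import Data.Rational using (ℚ; 0ℚ; _/_) renaming (_+_ to _+ℚ_)
open import Function.Bundles using (_↔_; Inverse)
open import Function.Definitions using (Injective)
open import Relation.Binary.PropositionalEquality using (_≡_; refl)
open import Relation.Nullary using (¬_)
open import Data.Empty using (⊥)

-- the rational a / d, with a / 0 := 0 (only used with d ≥ 1: endpoints of an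
-- edge have degree ≥ 1, and n ≥ 3 gives 3(n-2) ≥ 3)
frac : ℕ → ℕ → ℚ
frac a zero = 0ℚ
frac a (suc d) = (+ a) / suc d

record Graph (n : ℕ) : Set where
  field
    adj    : Fin n → Fin n → Bool
    sym    : ∀ i j → adj i j ≡ adj j i
    irrefl : ∀ i → adj i i ≡ false
open Graph public

module _ {n : ℕ} (G : Graph n) where

  sumℕ : (Fin n → ℕ) → ℕ
  sumℕ f = foldr (λ i acc → f i + acc) 0 (allFin n)

  sumℚ : (Fin n → ℚ) → ℚ
  sumℚ f = foldr (λ i acc → f i +ℚ acc) 0ℚ (allFin n)

  deg : Fin n → ℕ
  deg i = sumℕ (λ j → if adj G i j then 1 else 0)

  data Walk : Fin n → Fin n → ℕ → Set where
    here : ∀ {u} → Walk u u 0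
    step : ∀ {u w v k} → adj G u w ≡ true → Walk w v k → Walk u v (suc k)

  Connected : Set
  Connected = ∀ u v → ∃ λ k → Walk u v k

  Dist : Fin n → Fin n → ℕ → Set
  Dist u v k = Walk u v k × (∀ m → Walk u v m → k ≤ m)

  IsDiameter : ℕ → Set
  IsDiameter D = (∃ λ u → ∃ λ v → Dist u v D) × (∀ u v k → Dist u v k → k ≤ D)

  Cycle : Set
  Cycle = Σ ℕ λ k → Σ (Fin (suc (suc (suc k))) → Fin n) λ c →
            Injective _≡_ _≡_ c
          × (∀ (i : Fin (suc (suc k))) → adj G (c (inject₁ i)) (c (suc i)) ≡ true)
          × adj G (c (fromℕ (suc (suc k)))) (c zero) ≡ true

  IsTree : Set
  IsTree = Connected × ¬ Cycle

  H : ℚ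
  H = sumℚ λ i → sumℚ λ j →
        if adj G i j ∧ (toℕ i <ᵇ toℕ j) then frac 2 (deg i + deg j) else 0ℚ

delete : ∀ {m} → Graph (suc m) → Fin (suc m) → Graph m
delete G v = record
  { adj = λ i j → adj G (punchIn v i) (punchIn v j)
  ; sym = λ i j → sym G (punchIn v i) (punchIn v j)
  ; irrefl = λ i → irrefl G (punchIn v i) }

QuasiTree : ∀ {n} → Graph n → Set
QuasiTree {zero} G = ⊥   -- no vertex v to delete
QuasiTree {suc m} G = Connected G × ¬ IsTree G × Σ (Fin (suc m)) λ v → IsTree (delete G v)

-- graph isomorphism (possibly different orders; then no bijection exists)
Iso : ∀ {n m} → Graph n → Graph m → Set
Iso {n} {m} G G' = Σ (Fin n ↔ Fin m) λ σ →
  ∀ i j → adj G i j ≡ adj G' (Inverse.to σ i) (Inverse.to σ j)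

private
  isE : ∀ {n} → List (ℕ × ℕ) → Fin n → Fin n → Bool
  isE es i j = any (λ { (a , b) → (toℕ i ≡ᵇ a) ∧ (toℕ j ≡ᵇ b) }) es

-- U_{6,4}^{1,1}: 4-cycle 0-1-2-3-0, pendant 4 at 0, pendant 5 at 2 (opposite to 0)
U64 : Graph 6
U64 = record
  { adj = λ i j → isE es i j ∨ isE es j i
  ; sym = λ i j → ∨-comm (isE es i j) (isE es j i)
  ; irrefl = λ { zero → refl ; (suc zero) → refl ; (suc (suc zero)) → refl
               ; (suc (suc (suc zero))) → refl ; (suc (suc (suc (suc zero)))) → refl
               ; (suc (suc (suc (suc (suc zero))))) → refl } }
  where
  es : List (ℕ × ℕ)
  es = (0 , 1) ∷ (1 , 2) ∷ (2 , 3) ∷ (3 , 0) ∷ (0 , 4) ∷ (2 , 5) ∷ []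

-- U_{5,3}^{1,1}: triangle 0-1-2, pendant 3 at 0, pendant 4 at 1
U53 : Graph 5
U53 = record
  { adj = λ i j → isE es i j ∨ isE es j i
  ; sym = λ i j → ∨-comm (isE es i j) (isE es j i)
  ; irrefl = λ { zero → refl ; (suc zero) → refl ; (suc (suc zero)) → refl
               ; (suc (suc (suc zero))) → refl ; (suc (suc (suc (suc zero)))) → refl } }
  where
  es : List (ℕ × ℕ)
  es = (0 , 1) ∷ (1 , 2) ∷ (2 , 0) ∷ (0 , 3) ∷ (1 , 4) ∷ []

-- For 3 ≤ n ≤ 6 the theorem is a finite statement, so it is proved by evaluation.
-- A graph on Fin n is determined by the upper triangle of its adjacency matrix, and
-- for each of the 2^(n(n-1)/2) triangles a Boolean test certifies one of: the graph is
-- disconnected, it is acyclic, it is isomorphic to the excluded graph of that order,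
-- or it satisfies both bounds. For the bounds, H(G) is computed exactly as an integer multiple of
-- 1/27720 = 1/lcm(1,…,12), which suffices because every degree sum d_u + d_v is at
-- most 12; and D(G) is bounded by the least k such that all pairs of vertices are
-- joined by walks of length ≤ k. Both bounds increase with D, so checking them at
-- that k suffices.
module Submission where

open import Defs hiding (sym)
open import Data.Nat using (ℕ; _≤_; _*_; _∸_)
open import Data.Product using (_×_)
open import Relation.Nullary using (¬_)
open import Data.Integer using (+_)
open import Data.Rational using (ℚ; _/_; _+_; _-_) renaming (_*_ to _*ℚ_; _≤_ to _≤ℚ_)

open import Data.Bool using (Bool; true; false; T; not; _∧_; _∨_; if_then_else_)
open import Data.Bool.ListAction using (all; any)
open import Data.Bool.Properties using (T-∧; T-∨; T-≡)
import Data.Bool.Properties as Boolₚ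
open import Data.Empty using (⊥-elim)
open import Data.Fin using (Fin; zero; suc; toℕ; fromℕ; _≟_)
open import Data.Fin.Induction using (<-weakInduction)
open import Data.Fin.Properties using (0≢1+n; suc-injective)
import Data.Integer as ℤ
import Data.Integer.Properties as ℤₚ
open import Data.Integer.Tactic.RingSolver using (solve-∀)
open import Data.List using (List; []; _∷_; foldr; map; concatMap; upTo; length)
import Data.List as List
open import Data.List.Membership.Propositional.Properties using (∈-upTo⁺)
open import Data.List.Properties using (length-tabulate; foldr-cong)
import Data.List.Relation.Unary.All as All
open import Data.List.Relation.Unary.All.Properties using (all⁺)
open import Data.List.Relation.Unary.Any using (satisfied)
open import Data.List.Relation.Unary.Any.Properties using (any⁻)
open import Data.Maybe using (Maybe; just; nothing; fromMaybe)
import Data.Maybe as Maybe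
import Data.Nat as ℕ
open import Data.Nat using (zero; suc; z≤n; s≤s; NonZero; _<ᵇ_)
import Data.Nat.Properties as ℕₚ
open import Data.Product using (∃; _,_; proj₁; proj₂)
import Data.Rational as ℚ
open import Data.Rational.Properties using (toℚᵘ-injective; toℚᵘ-fromℚᵘ; toℚᵘ-homo-+; toℚᵘ-cancel-≤)
import Data.Rational.Properties as ℚₚ
open import Data.Rational.Unnormalised using (mkℚᵘ; *≡*; *≤*)
import Data.Rational.Unnormalised as ℚᵘ
import Data.Rational.Unnormalised.Properties as ℚᵘₚ
open import Data.Sum using (_⊎_; inj₁; inj₂)
open import Data.Unit using (⊤; tt)
open import Data.Vec using (Vec; []; _∷_; lookup; tabulate)
import Data.Vec as Vec
open import Data.Vec.Properties using (lookup∘tabulate)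
open import Function using (_∘_)
open import Function.Bundles using (Equivalence; mk↔ₛ′)
open import Relation.Binary.Definitions using (DecidableEquality)
open import Relation.Binary.PropositionalEquality
  using (_≡_; _≢_; refl; sym; trans; cong; cong₂; subst; module ≡-Reasoning)
open import Relation.Nullary.Decidable using (Dec; ⌊_⌋; toWitness; fromWitness; _×-dec_; _→-dec_)

open Equivalence using (to; from)

allᶠ : ∀ {n} → (Fin n → Bool) → Bool
allᶠ {zero}  f = true
allᶠ {suc n} f = f zero ∧ allᶠ (f ∘ suc)

anyᶠ : ∀ {n} → (Fin n → Bool) → Bool
anyᶠ {zero}  f = false
anyᶠ {suc n} f = f zero ∨ anyᶠ (f ∘ suc)

allᶠ-sound : ∀ {n} (f : Fin n → Bool) → T (allᶠ f) → ∀ i → T (f i)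
allᶠ-sound {suc n} f h zero    = proj₁ (to (T-∧ {f zero}) h)
allᶠ-sound {suc n} f h (suc i) = allᶠ-sound (f ∘ suc) (proj₂ (to (T-∧ {f zero}) h)) i

anyᶠ-sound : ∀ {n} (f : Fin n → Bool) → T (anyᶠ f) → ∃ λ i → T (f i)
anyᶠ-sound {suc n} f h with to (T-∨ {f zero}) h
... | inj₁ h₀ = zero , h₀
... | inj₂ h′ with anyᶠ-sound (f ∘ suc) h′
...   | i , hᵢ = suc i , hᵢ

T-not⇒¬T : ∀ {b} → T (not b) → ¬ T b
T-not⇒¬T {false} _ ()

¬T⇒T-not : ∀ {b} → ¬ T b → T (not b)
¬T⇒T-not {false} _  = tt
¬T⇒T-not {true}  ¬t = ¬t tt

T-∨₄ : ∀ {a b c d} → T (a ∨ (b ∨ (c ∨ d))) → T a ⊎ T b ⊎ T c ⊎ T d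
T-∨₄ {true}                         h = inj₁ h
T-∨₄ {false} {true}                 h = inj₂ (inj₁ h)
T-∨₄ {false} {false} {true}         h = inj₂ (inj₂ (inj₁ h))
T-∨₄ {false} {false} {false} {true} h = inj₂ (inj₂ (inj₂ h))

≟-sound : ∀ {X : Set} (_≟_ : DecidableEquality X) {x y} → T ⌊ x ≟ y ⌋ → x ≡ y
≟-sound _≟_ {x} {y} = toWitness {a? = x ≟ y}

allℕ< : ℕ → (ℕ → Bool) → Bool
allℕ< k f = all f (upTo k)

allℕ<-sound : ∀ k (f : ℕ → Bool) → T (allℕ< k f) → ∀ {d} → d ℕ.< k → T (f d)
allℕ<-sound k f h d<k = All.lookup (all⁺ f (upTo k) h) (∈-upTo⁺ d<k)

decide-below : ∀ k {P : ℕ → Set} (P? : ∀ d → Dec (P d)) → T (allℕ< k λ d → ⌊ P? d ⌋) →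
               ∀ {d} → d ℕ.< k → P d
decide-below k P? h {d} d<k = toWitness {a? = P? d} (allℕ<-sound k _ h d<k)

decide-below² : ∀ k {P : ℕ → ℕ → Set} (P? : ∀ m d → Dec (P m d)) →
                T (allℕ< k λ m → allℕ< k λ d → ⌊ P? m d ⌋) → ∀ {m d} → m ℕ.< k → d ℕ.< k → P m d
decide-below² k P? h {m} m<k = decide-below k (P? m) (allℕ<-sound k _ h m<k)

-- Walks, connectivity and cycles, decided on adjacency matrices

Matrix : ℕ → Set
Matrix n = Fin n → Fin n → Bool

record Represents {n} (G : Graph n) (A : Matrix n) : Set where
  constructor represents
  field adj≡ : ∀ i j → adj G i j ≡ A i j
open Represents

expand : ∀ {n} → Matrix n → Vec Bool n → Vec Bool n
expand A R = tabulate λ v → lookup R v ∨ anyᶠ λ w → lookup R w ∧ A w v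

ball : ∀ {n} → Matrix n → ℕ → Fin n → Vec Bool n
ball A zero    u = tabulate λ v → ⌊ u ≟ v ⌋
ball A (suc k) u = expand A (ball A k u)

reachesᵇ : ∀ {n} → Matrix n → ℕ → Fin n → Fin n → Bool
reachesᵇ A k u = lookup (ball A k u)

reachesᵇ-refl : ∀ {n} (A : Matrix n) k u → T (reachesᵇ A k u u)
reachesᵇ-refl A zero    u = subst T (sym (lookup∘tabulate _ u)) (fromWitness refl)
reachesᵇ-refl A (suc k) u = subst T (sym (lookup∘tabulate _ u)) (from T-∨ (inj₁ (reachesᵇ-refl A k u)))

reachesAllᵇ : ∀ {n} → Matrix n → ℕ → Bool
reachesAllᵇ A k = allᶠ λ u → allᶠ (reachesᵇ A k u)

closedᵇ : ∀ {n} → Matrix n → (Fin n → Bool) → Bool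
closedᵇ A S = allᶠ λ x → allᶠ λ y → not (S x ∧ A x y) ∨ S y

closedᵇ-sound : ∀ {n} (A : Matrix n) S → T (closedᵇ A S) → ∀ {x y} → T (S x) → T (A x y) → T (S y)
closedᵇ-sound A S c {x} {y} Sx Axy with S x | A x y | allᶠ-sound _ (allᶠ-sound _ c x) y
... | true  | true  | Sy = Sy
... | false | _     | _  = ⊥-elim Sx
... | true  | false | _  = ⊥-elim Axy

-- A closed set containing u but not v separates u from v.
excludesᵇ : ∀ {n} → Matrix n → Vec Bool n → Fin n → Bool
excludesᵇ A R v = closedᵇ A (lookup R) ∧ not (lookup R v)

disconnectedᵇ : ∀ {n} → Matrix n → Bool
disconnectedᵇ {zero}  A = false
disconnectedᵇ {suc n} A = anyᶠ (excludesᵇ A (ball A (suc n) zero))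

isEdgeᵇ : ∀ {n} → Fin n → Fin n → Fin n → Fin n → Bool
isEdgeᵇ a b x y = (⌊ x ≟ a ⌋ ∧ ⌊ y ≟ b ⌋) ∨ (⌊ x ≟ b ⌋ ∧ ⌊ y ≟ a ⌋)

≟-∧-≟-sound : ∀ {n} {x a y b : Fin n} → T (⌊ x ≟ a ⌋ ∧ ⌊ y ≟ b ⌋) → x ≡ a × y ≡ b
≟-∧-≟-sound {x = x} {a} h with to (T-∧ {⌊ x ≟ a ⌋}) h
... | x≡a , y≡b = ≟-sound _≟_ x≡a , ≟-sound _≟_ y≡b

isEdgeᵇ-sound : ∀ {n} {a b x y : Fin n} → T (isEdgeᵇ a b x y) → (x ≡ a × y ≡ b) ⊎ (x ≡ b × y ≡ a)
isEdgeᵇ-sound {a = a} {b} {x} {y} h with to (T-∨ {⌊ x ≟ a ⌋ ∧ ⌊ y ≟ b ⌋}) h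
... | inj₁ h′ = inj₁ (≟-∧-≟-sound h′)
... | inj₂ h′ = inj₂ (≟-∧-≟-sound h′)

withoutEdge : ∀ {n} → Matrix n → Fin n → Fin n → Matrix n
withoutEdge A a b x y = A x y ∧ not (isEdgeᵇ a b x y)

withoutEdge-keeps : ∀ {n} (A : Matrix n) {a b x y} → T (A x y) →
                    ¬ ((x ≡ a × y ≡ b) ⊎ (x ≡ b × y ≡ a)) → T (withoutEdge A a b x y)
withoutEdge-keeps A Axy ¬ab = from T-∧ (Axy , ¬T⇒T-not (¬ab ∘ isEdgeᵇ-sound))

bridgeᵇ : ∀ {n} → Matrix n → Fin n → Fin n → Bool
bridgeᵇ {n} A a b = excludesᵇ (withoutEdge A a b) (ball (withoutEdge A a b) n b) a

acyclicᵇ : ∀ {n} → Matrix n → Bool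
acyclicᵇ A = allᶠ λ a → allᶠ λ b → not (A a b) ∨ bridgeᵇ A a b

-- Unless the search stops early, the result k + fuel is not certified; the callers
-- re-check reachesAllᵇ at the returned value.
firstReachingAll : ∀ {n} → Matrix n → (fuel k : ℕ) → ℕ
firstReachingAll A zero       k = k
firstReachingAll A (suc fuel) k = if reachesAllᵇ A k then k else firstReachingAll A fuel (suc k)

firstReachingAll-≤ : ∀ {n} (A : Matrix n) fuel k → firstReachingAll A fuel k ≤ fuel ℕ.+ k
firstReachingAll-≤ A zero       k = ℕₚ.≤-refl
firstReachingAll-≤ A (suc fuel) k with reachesAllᵇ A k
... | true  = ℕₚ.m≤n+m k (suc fuel)
... | false = subst (firstReachingAll A fuel (suc k) ≤_) (ℕₚ.+-suc fuel k) (firstReachingAll-≤ A fuel (suc k))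

diameterBound : ∀ {n} → Matrix n → ℕ
diameterBound {n} A = firstReachingAll A n 0

diameterBound-≤ : ∀ {n} (A : Matrix n) → diameterBound A ≤ n
diameterBound-≤ {n} A = subst (diameterBound A ≤_) (ℕₚ.+-identityʳ n) (firstReachingAll-≤ A n 0)

module _ {n} {G : Graph n} {A : Matrix n} (G≐A : Represents G A) where

  graph-edge : ∀ {u v} → T (A u v) → adj G u v ≡ true
  graph-edge {u} {v} Auv = trans (adj≡ G≐A u v) (to T-≡ Auv)

  matrix-edge : ∀ {u v} → adj G u v ≡ true → T (A u v)
  matrix-edge {u} {v} e = from T-≡ (trans (sym (adj≡ G≐A u v)) e)

  snoc : ∀ {u w v k} → Walk G u w k → T (A w v) → Walk G u v (suc k)
  snoc here       Awv = step (graph-edge Awv) here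
  snoc (step e w) Awv = step e (snoc w Awv)

  reachesᵇ-sound : ∀ k u v → T (reachesᵇ A k u v) → ∃ λ m → m ≤ k × Walk G u v m
  reachesᵇ-sound zero u v h with toWitness {a? = u ≟ v} (subst T (lookup∘tabulate _ v) h)
  ... | refl = 0 , z≤n , here
  reachesᵇ-sound (suc k) u v h with to T-∨ (subst T (lookup∘tabulate _ v) h)
  ... | inj₁ h′ with reachesᵇ-sound k u v h′
  ...   | m , m≤k , w = m , ℕₚ.m≤n⇒m≤1+n m≤k , w
  reachesᵇ-sound (suc k) u v h | inj₂ h′ with anyᶠ-sound _ h′
  ...   | x , hx with to T-∧ hx
  ...     | ux , Axv with reachesᵇ-sound k u x ux
  ...       | m , m≤k , w = suc m , s≤s m≤k , snoc w Axv

  walk-preserves-closed : ∀ S → T (closedᵇ A S) → ∀ {u v k} → Walk G u v k → T (S u) → T (S v)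
  walk-preserves-closed S c here       Su = Su
  walk-preserves-closed S c (step e p) Su = walk-preserves-closed S c p (closedᵇ-sound A S c Su (matrix-edge e))

  excludes-ball⇒¬Connected : ∀ k u → T (anyᶠ (excludesᵇ A (ball A k u))) → ¬ Connected G
  excludes-ball⇒¬Connected k u h connected with anyᶠ-sound _ h
  ... | v , excl with to T-∧ excl | connected u v
  ...   | closed , v∉ball | _ , u⟶v =
    T-not⇒¬T v∉ball (walk-preserves-closed (reachesᵇ A k u) closed u⟶v (reachesᵇ-refl A k u))

  diameter-≤ : ∀ {D} k → T (reachesAllᵇ A k) → IsDiameter G D → D ≤ k
  diameter-≤ k h ((u , v , _ , minimal) , _) with reachesᵇ-sound k u v (allᶠ-sound _ (allᶠ-sound _ h u) v)
  ... | m , m≤k , w = ℕₚ.≤-trans (minimal m w) m≤k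

  -- With a = c 0 and b = c 1, the rest of the cycle is a walk from b back to a that
  -- avoids the edge ab, so ab cannot be a bridge.
  acyclicᵇ-sound : T (acyclicᵇ A) → ¬ Cycle G
  acyclicᵇ-sound h (k , c , c-injective , edges , closing) = T-not⇒¬T a∉S S-a
    where
    a = c zero
    b = c (suc zero)
    A′ = withoutEdge A a b
    S = reachesᵇ A′ n b

    bridge : T (bridgeᵇ A a b)
    bridge with to (T-∨ {not (A a b)}) (allᶠ-sound _ (allᶠ-sound _ h a) b)
    ... | inj₁ ¬Aab = ⊥-elim (T-not⇒¬T ¬Aab (matrix-edge (edges zero)))
    ... | inj₂ br   = br

    closed = proj₁ (to T-∧ bridge)
    a∉S = proj₂ (to T-∧ bridge)

    later≢a : ∀ {j} → c (suc j) ≢ a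
    later≢a e = 0≢1+n (sym (c-injective e))

    S-later : ∀ j → T (S (c (suc j)))
    S-later = <-weakInduction (λ j → T (S (c (suc j)))) (reachesᵇ-refl A′ n b)
      λ i S-ci → closedᵇ-sound A′ S closed S-ci
        (withoutEdge-keeps A (matrix-edge (edges (suc i)))
          λ { (inj₁ (e , _)) → later≢a e ; (inj₂ (_ , e)) → later≢a e })

    S-a : T (S a)
    S-a = closedᵇ-sound A′ S closed (S-later (fromℕ (suc k)))
      (withoutEdge-keeps A (matrix-edge closing)
        λ { (inj₁ (e , _)) → later≢a e ; (inj₂ (e , _)) → 0≢1+n (suc-injective (sym (c-injective e))) })

disconnectedᵇ-sound : ∀ {n} {G : Graph n} {A} → Represents G A → T (disconnectedᵇ A) → ¬ Connected G
disconnectedᵇ-sound {suc n} G≐A = excludes-ball⇒¬Connected G≐A (suc n) zero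

+/-distribʳ-+ : ∀ a b d .{{_ : NonZero d}} → (+ a) / d + (+ b) / d ≡ (+ (a ℕ.+ b)) / d
+/-distribʳ-+ a b (suc d-1) = toℚᵘ-injective (begin-equality
  ℚ.toℚᵘ (ℚ.fromℚᵘ p + ℚ.fromℚᵘ q)              ≃⟨ toℚᵘ-homo-+ (ℚ.fromℚᵘ p) (ℚ.fromℚᵘ q) ⟩
  ℚ.toℚᵘ (ℚ.fromℚᵘ p) ℚᵘ.+ ℚ.toℚᵘ (ℚ.fromℚᵘ q) ≃⟨ ℚᵘₚ.+-cong (toℚᵘ-fromℚᵘ p) (toℚᵘ-fromℚᵘ q) ⟩
  p ℚᵘ.+ q                                       ≃⟨ *≡* cross-multiplied ⟩
  mkℚᵘ (+ (a ℕ.+ b)) d-1                         ≃⟨ ℚᵘₚ.≃-sym (toℚᵘ-fromℚᵘ _) ⟩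
  ℚ.toℚᵘ (ℚ.fromℚᵘ (mkℚᵘ (+ (a ℕ.+ b)) d-1))    ∎)
  where
  open ℚᵘₚ.≤-Reasoning
  d = suc d-1
  p = mkℚᵘ (+ a) d-1
  q = mkℚᵘ (+ b) d-1
  distrib : ∀ (x y c : ℤ.ℤ) → (x ℤ.* c ℤ.+ y ℤ.* c) ℤ.* c ≡ (x ℤ.+ y) ℤ.* (c ℤ.* c)
  distrib = solve-∀
  cross-multiplied : (+ a ℤ.* + d ℤ.+ + b ℤ.* + d) ℤ.* + d ≡ + (a ℕ.+ b) ℤ.* (+ d ℤ.* + d)
  cross-multiplied = trans (distrib (+ a) (+ b) (+ d)) (cong (ℤ._* (+ d ℤ.* + d)) (sym (ℤₚ.pos-+ a b)))

+/-monoˡ-≤ : ∀ {a b} d .{{_ : NonZero d}} → a ℕ.≤ b → (+ a) / d ≤ℚ (+ b) / d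
+/-monoˡ-≤ {a} {b} (suc d-1) a≤b = toℚᵘ-cancel-≤ (begin
  ℚ.toℚᵘ (ℚ.fromℚᵘ (mkℚᵘ (+ a) d-1)) ≃⟨ toℚᵘ-fromℚᵘ _ ⟩
  mkℚᵘ (+ a) d-1                     ≤⟨ *≤* (ℤₚ.*-monoʳ-≤-nonNeg (+ suc d-1) (ℤ.+≤+ a≤b)) ⟩
  mkℚᵘ (+ b) d-1                     ≃⟨ ℚᵘₚ.≃-sym (toℚᵘ-fromℚᵘ _) ⟩
  ℚ.toℚᵘ (ℚ.fromℚᵘ (mkℚᵘ (+ b) d-1)) ∎)
  where open ℚᵘₚ.≤-Reasoning

-- The harmonic index in units of 1/27720

scaled : ℕ → ℚ
scaled a = (+ a) / 27720

-- 2/s = twoOver s / 27720 whenever s divides 55440, in particular for 1 ≤ s ≤ 12.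
twoOver : ℕ → ℕ
twoOver zero    = 0
twoOver (suc s) = 55440 ℕ./ suc s

frac2-scaled : ∀ {s} → s ℕ.< 13 → frac 2 s ≡ scaled (twoOver s)
frac2-scaled = decide-below 13 (λ s → frac 2 s ℚ.≟ scaled (twoOver s)) _

foldr-scaled : ∀ {X : Set} (f : X → ℚ) (g : X → ℕ) → (∀ x → f x ≡ scaled (g x)) → ∀ xs →
               foldr (λ x acc → f x + acc) ℚ.0ℚ xs ≡ scaled (foldr (λ x acc → g x ℕ.+ acc) 0 xs)
foldr-scaled f g f≡g []       = refl
foldr-scaled f g f≡g (x ∷ xs) = begin
  f x + foldr (λ x acc → f x + acc) ℚ.0ℚ xs                  ≡⟨ cong₂ _+_ (f≡g x) (foldr-scaled f g f≡g xs) ⟩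
  scaled (g x) + scaled (foldr (λ x acc → g x ℕ.+ acc) 0 xs) ≡⟨ +/-distribʳ-+ (g x) _ 27720 ⟩
  scaled (g x ℕ.+ foldr (λ x acc → g x ℕ.+ acc) 0 xs)         ∎
  where open ≡-Reasoning

sumᶠ : ∀ {n} → (Fin n → ℕ) → ℕ
sumᶠ {n} f = foldr (λ i acc → f i ℕ.+ acc) 0 (List.allFin n)

degree : ∀ {n} → Matrix n → Fin n → ℕ
degree A i = sumᶠ λ j → if A i j then 1 else 0

indicatorSum-≤-length : ∀ {X : Set} (p : X → Bool) xs →
                        foldr (λ x acc → (if p x then 1 else 0) ℕ.+ acc) 0 xs ≤ length xs
indicatorSum-≤-length p []       = z≤n
indicatorSum-≤-length p (x ∷ xs) with p x
... | true  = s≤s (indicatorSum-≤-length p xs)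
... | false = ℕₚ.m≤n⇒m≤1+n (indicatorSum-≤-length p xs)

degree-≤ : ∀ {n} (A : Matrix n) i → degree A i ≤ n
degree-≤ {n} A i =
  subst (degree A i ≤_) (length-tabulate {n = n} (λ j → j)) (indicatorSum-≤-length (A i) (List.allFin n))

harmonicWith : ∀ {n} → Matrix n → Vec ℕ n → ℕ
harmonicWith A d = sumᶠ λ i → sumᶠ λ j →
  if A i j ∧ (toℕ i <ᵇ toℕ j) then twoOver (lookup d i ℕ.+ lookup d j) else 0

scaledHarmonic : ∀ {n} → Matrix n → ℕ
scaledHarmonic A = harmonicWith A (tabulate (degree A))

module _ {n} {G : Graph n} {A : Matrix n} (G≐A : Represents G A) where

  deg≡degree : ∀ i → deg G i ≡ degree A i
  deg≡degree i =
    foldr-cong (λ j acc → cong (λ e → (if e then 1 else 0) ℕ.+ acc) (adj≡ G≐A i j)) refl (List.allFin n)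

  H≡scaledHarmonic : n ≤ 6 → H G ≡ scaled (scaledHarmonic A)
  H≡scaledHarmonic n≤6 = foldr-scaled _ _ (λ i → foldr-scaled _ _ (term i) (List.allFin n)) (List.allFin n)
    where
    d = tabulate (degree A)
    term : ∀ i j → (if adj G i j ∧ (toℕ i <ᵇ toℕ j) then frac 2 (deg G i ℕ.+ deg G j) else ℚ.0ℚ)
                 ≡ scaled (if A i j ∧ (toℕ i <ᵇ toℕ j) then twoOver (lookup d i ℕ.+ lookup d j) else 0)
    term i j rewrite adj≡ G≐A i j | deg≡degree i | deg≡degree j
                   | lookup∘tabulate (degree A) i | lookup∘tabulate (degree A) j
      with A i j ∧ (toℕ i <ᵇ toℕ j)
    ... | true  = frac2-scaled (s≤s (ℕₚ.+-mono-≤ (ℕₚ.≤-trans (degree-≤ A i) n≤6) (ℕₚ.≤-trans (degree-≤ A j) n≤6)))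
    ... | false = refl

lowerBound₁ : ℕ → ℕ → ℚ
lowerBound₁ n D = (((+ D) / 1) + ((+ 5) / 3)) - ((+ n) / 2)

lowerBound₂ : ℕ → ℕ → ℚ
lowerBound₂ n D = (((+ 1) / 2) + frac 2 (3 * (n ∸ 2))) *ℚ ((+ D) / 1)

-- 27720 times the lower bounds (the first one truncated at 0).
scaledBound₁ : ℕ → ℕ → ℕ
scaledBound₁ n D = (27720 * D ℕ.+ 46200) ∸ 13860 * n

scaledBound₂ : ℕ → ℕ → ℕ
scaledBound₂ n D = (13860 ℕ.+ twoOver (3 * (n ∸ 2))) * D

scaledBound₁-mono : ∀ n {D k} → D ≤ k → scaledBound₁ n D ≤ scaledBound₁ n k
scaledBound₁-mono n D≤k = ℕₚ.∸-monoˡ-≤ (13860 * n) (ℕₚ.+-monoˡ-≤ 46200 (ℕₚ.*-monoʳ-≤ 27720 D≤k))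

scaledBound₂-mono : ∀ n {D k} → D ≤ k → scaledBound₂ n D ≤ scaledBound₂ n k
scaledBound₂-mono n = ℕₚ.*-monoʳ-≤ (13860 ℕ.+ twoOver (3 * (n ∸ 2)))

lowerBounds-≤-scaled : ∀ {n D} → 3 ≤ n → n ≤ 6 → D ≤ 6 →
                       lowerBound₁ n D ≤ℚ scaled (scaledBound₁ n D) × lowerBound₂ n D ≤ℚ scaled (scaledBound₂ n D)
lowerBounds-≤-scaled 3≤n n≤6 D≤6 = decide-below² 7 bounds? _ (s≤s n≤6) (s≤s D≤6) 3≤n
  where
  bounds? = λ n D → 3 ℕₚ.≤? n →-dec (lowerBound₁ n D ℚₚ.≤? scaled (scaledBound₁ n D)
                                      ×-dec lowerBound₂ n D ℚₚ.≤? scaled (scaledBound₂ n D))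

boundsHoldAtᵇ : ∀ {n} → Matrix n → (k h : ℕ) → Bool
boundsHoldAtᵇ {n} A k h = reachesAllᵇ A k ∧ ((scaledBound₁ n k ℕ.≤ᵇ h) ∧ (scaledBound₂ n k ℕ.≤ᵇ h))

boundsHoldᵇ : ∀ {n} → Matrix n → Bool
boundsHoldᵇ A = boundsHoldAtᵇ A (diameterBound A) (scaledHarmonic A)

module _ {n} {G : Graph n} {A : Matrix n} (G≐A : Represents G A) where

  boundsHoldᵇ-sound : ∀ {D} → 3 ≤ n → n ≤ 6 → IsDiameter G D → T (boundsHoldᵇ A) →
                      lowerBound₁ n D ≤ℚ H G × lowerBound₂ n D ≤ℚ H G
  boundsHoldᵇ-sound {D} 3≤n n≤6 diam h with to T-∧ h
  ... | reachesAll , below with to T-∧ below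
  ...   | below₁ , below₂ = bound lowerBound₁ scaledBound₁ (scaledBound₁-mono n) (proj₁ at-D) below₁
                          , bound lowerBound₂ scaledBound₂ (scaledBound₂-mono n) (proj₂ at-D) below₂
    where
    k = diameterBound A
    D≤k : D ≤ k
    D≤k = diameter-≤ G≐A k reachesAll diam
    at-D = lowerBounds-≤-scaled 3≤n n≤6 (ℕₚ.≤-trans D≤k (ℕₚ.≤-trans (diameterBound-≤ A) n≤6))
    bound : ∀ (lower : ℕ → ℕ → ℚ) (scaledLower : ℕ → ℕ → ℕ) →
            (∀ {d k} → d ≤ k → scaledLower n d ≤ scaledLower n k) →
            lower n D ≤ℚ scaled (scaledLower n D) → T (scaledLower n k ℕ.≤ᵇ scaledHarmonic A) → lower n D ≤ℚ H G
    bound lower scaledLower mono lower≤ below = begin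
      lower n D                 ≤⟨ lower≤ ⟩
      scaled (scaledLower n D)  ≤⟨ +/-monoˡ-≤ {scaledLower n D} {scaledHarmonic A} 27720
                                     (ℕₚ.≤-trans (mono D≤k) (ℕₚ.≤ᵇ⇒≤ _ _ below)) ⟩
      scaled (scaledHarmonic A) ≡⟨ sym (H≡scaledHarmonic G≐A n≤6) ⟩
      H G                       ∎
      where open ℚₚ.≤-Reasoning

-- Isomorphism search

insertions : ∀ {X : Set} {k} → X → Vec X k → List (Vec X (suc k))
insertions x []       = (x ∷ []) ∷ []
insertions x (y ∷ ys) = (x ∷ y ∷ ys) ∷ map (y ∷_) (insertions x ys)

permutations : ∀ {X : Set} {k} → Vec X k → List (Vec X k)
permutations []       = [] ∷ []
permutations (x ∷ xs) = concatMap (insertions x) (permutations xs)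

findᶠ : ∀ {n} → (Fin n → Bool) → Maybe (Fin n)
findᶠ {zero}  f = nothing
findᶠ {suc n} f = if f zero then just zero else Maybe.map suc (findᶠ (f ∘ suc))

preimage : ∀ {n} → (Fin n → Fin n) → Fin n → Fin n
preimage p j = fromMaybe j (findᶠ λ i → ⌊ p i ≟ j ⌋)

module _ {n} (U : Graph n) where

  isIsoᵇ : Matrix n → (Fin n → Fin n) → Bool
  isIsoᵇ A p = allᶠ (λ i → allᶠ λ j → ⌊ A i j Boolₚ.≟ adj U (p i) (p j) ⌋)
             ∧ (allᶠ (λ i → ⌊ preimage p (p i) ≟ i ⌋) ∧ allᶠ (λ j → ⌊ p (preimage p j) ≟ j ⌋))

  isomorphicᵇ : Matrix n → Bool
  isomorphicᵇ A = any (isIsoᵇ A ∘ lookup) (permutations (Vec.allFin n))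

  isomorphicᵇ-sound : ∀ {G A} → Represents G A → T (isomorphicᵇ A) → Iso G U
  isomorphicᵇ-sound {G} {A} G≐A h with satisfied (any⁻ (isIsoᵇ A ∘ lookup) (permutations (Vec.allFin n)) h)
  ... | v , iso with to T-∧ iso
  ...   | preserves , inverses with to T-∧ inverses
  ...     | left , right =
    mk↔ₛ′ p (preimage p) (λ j → ≟-sound _≟_ (allᶠ-sound _ right j)) (λ i → ≟-sound _≟_ (allᶠ-sound _ left i))
    , λ i j → trans (adj≡ G≐A i j) (≟-sound Boolₚ._≟_ (allᶠ-sound _ (allᶠ-sound _ preserves i) j))
    where p = lookup v

-- The first component lists the neighbours of vertex 0 among 1, …, n; the rest is the
-- triangle of the subgraph on the remaining vertices.
Triangle : ℕ → Set
Triangle zero    = ⊤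
Triangle (suc n) = Vec Bool n × Triangle n

fromTriangle : ∀ {n} → Triangle n → Matrix n
fromTriangle {suc n} (r , t) zero    zero    = false
fromTriangle {suc n} (r , t) zero    (suc j) = lookup r j
fromTriangle {suc n} (r , t) (suc i) zero    = lookup r i
fromTriangle {suc n} (r , t) (suc i) (suc j) = fromTriangle t i j

triangle : ∀ {n} → Matrix n → Triangle n
triangle {zero}  A = tt
triangle {suc n} A = tabulate (A zero ∘ suc) , triangle (λ i j → A (suc i) (suc j))

fromTriangle-triangle : ∀ {n} (A : Matrix n) → (∀ i → A i i ≡ false) → (∀ i j → A i j ≡ A j i) →
                        ∀ i j → A i j ≡ fromTriangle (triangle A) i j
fromTriangle-triangle A irr sym′ zero    zero    = irr zero
fromTriangle-triangle A irr sym′ zero    (suc j) = sym (lookup∘tabulate _ j)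
fromTriangle-triangle A irr sym′ (suc i) zero    = trans (sym′ (suc i) zero) (sym (lookup∘tabulate _ i))
fromTriangle-triangle A irr sym′ (suc i) (suc j) =
  fromTriangle-triangle (λ i j → A (suc i) (suc j)) (irr ∘ suc) (λ i j → sym′ (suc i) (suc j)) i j

represents-fromTriangle : ∀ {n} (G : Graph n) → Represents G (fromTriangle (triangle (adj G)))
represents-fromTriangle G = represents (fromTriangle-triangle (adj G) (irrefl G) (Graph.sym G))

allVecᵇ : ∀ k → (Vec Bool k → Bool) → Bool
allVecᵇ zero    P = P []
allVecᵇ (suc k) P = allVecᵇ k (P ∘ (true ∷_)) ∧ allVecᵇ k (P ∘ (false ∷_))

allVecᵇ-sound : ∀ k P → T (allVecᵇ k P) → ∀ v → T (P v)
allVecᵇ-sound zero    P h []          = h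
allVecᵇ-sound (suc k) P h (true ∷ v)  = allVecᵇ-sound k _ (proj₁ (to (T-∧ {allVecᵇ k (P ∘ (true ∷_))}) h)) v
allVecᵇ-sound (suc k) P h (false ∷ v) = allVecᵇ-sound k _ (proj₂ (to (T-∧ {allVecᵇ k (P ∘ (true ∷_))}) h)) v

allTrianglesᵇ : ∀ n → (Triangle n → Bool) → Bool
allTrianglesᵇ zero    P = P tt
allTrianglesᵇ (suc n) P = allVecᵇ n λ r → allTrianglesᵇ n λ t → P (r , t)

allTrianglesᵇ-sound : ∀ n P → T (allTrianglesᵇ n P) → ∀ t → T (P t)
allTrianglesᵇ-sound zero    P h tt      = h
allTrianglesᵇ-sound (suc n) P h (r , t) = allTrianglesᵇ-sound n _ (allVecᵇ-sound n _ h r) t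

verdictᵇ : ∀ {n} → (Matrix n → Bool) → Matrix n → Bool
verdictᵇ excluded A = boundsHoldᵇ A ∨ (disconnectedᵇ A ∨ (acyclicᵇ A ∨ excluded A))

module _ {n} {G : Graph n} {A : Matrix n} (G≐A : Represents G A) where

  verdictᵇ-sound : ∀ {D} (excluded : Matrix n → Bool) → ¬ T (excluded A) → 3 ≤ n → n ≤ 6 →
                   Connected G → ¬ IsTree G → IsDiameter G D → T (verdictᵇ excluded A) →
                   lowerBound₁ n D ≤ℚ H G × lowerBound₂ n D ≤ℚ H G
  verdictᵇ-sound {D} excluded ¬excluded 3≤n n≤6 connected ¬tree diam verdict =
    conclude (T-∨₄ {boundsHoldᵇ A} {disconnectedᵇ A} {acyclicᵇ A} {excluded A} verdict)
    where
    conclude : T (boundsHoldᵇ A) ⊎ T (disconnectedᵇ A) ⊎ T (acyclicᵇ A) ⊎ T (excluded A) →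
               lowerBound₁ n D ≤ℚ H G × lowerBound₂ n D ≤ℚ H G
    conclude (inj₁ holds)                 = boundsHoldᵇ-sound G≐A 3≤n n≤6 diam holds
    conclude (inj₂ (inj₁ disconnected))   = ⊥-elim (disconnectedᵇ-sound G≐A disconnected connected)
    conclude (inj₂ (inj₂ (inj₁ acyclic))) = ⊥-elim (¬tree (connected , acyclicᵇ-sound G≐A acyclic))
    conclude (inj₂ (inj₂ (inj₂ excl)))    = ⊥-elim (¬excluded excl)

-- The check is an equation with true, not a proof of T, so that it is decided by the
-- conversion checker (refl), which evaluates it several times faster.
bounds-by-exhaustion : ∀ {n} (excluded : Matrix n → Bool) →
  allTrianglesᵇ n (λ t → verdictᵇ excluded (fromTriangle t)) ≡ true →
  ∀ (G : Graph n) {D} → ¬ T (excluded (fromTriangle (triangle (adj G)))) → 3 ≤ n → n ≤ 6 →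
  Connected G → ¬ IsTree G → IsDiameter G D →
  lowerBound₁ n D ≤ℚ H G × lowerBound₂ n D ≤ℚ H G
bounds-by-exhaustion {n} excluded check G {D} ¬excluded 3≤n n≤6 connected ¬tree diam =
  verdictᵇ-sound (represents-fromTriangle G) {D} excluded ¬excluded 3≤n n≤6 connected ¬tree diam
    (allTrianglesᵇ-sound n (λ t → verdictᵇ excluded (fromTriangle t)) (from T-≡ check) (triangle (adj G)))

-- D is passed explicitly: inferring it by unification makes Agda normalise the
-- rational arithmetic in the bounds, which is prohibitively slow.
lemma3p1 : ∀ (n : ℕ) (G : Graph n) (D : ℕ) →
    3 ≤ n → n ≤ 6 → QuasiTree G → ¬ Iso G U64 → ¬ Iso G U53 → IsDiameter G D →
    ((((+ D) / 1) + ((+ 5) / 3)) - ((+ n) / 2) ≤ℚ H G)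
      × ((((+ 1) / 2) + frac 2 (3 * (n ∸ 2))) *ℚ ((+ D) / 1) ≤ℚ H G)
lemma3p1 0 G D ()
lemma3p1 1 G D (s≤s ())
lemma3p1 2 G D (s≤s (s≤s ()))
lemma3p1 3 G D 3≤n n≤6 (connected , ¬tree , _) _ _ diam =
  bounds-by-exhaustion (λ _ → false) refl G {D} (λ ()) 3≤n n≤6 connected ¬tree diam
lemma3p1 4 G D 3≤n n≤6 (connected , ¬tree , _) _ _ diam =
  bounds-by-exhaustion (λ _ → false) refl G {D} (λ ()) 3≤n n≤6 connected ¬tree diam
lemma3p1 5 G D 3≤n n≤6 (connected , ¬tree , _) _ ¬U53 diam =
  bounds-by-exhaustion (isomorphicᵇ U53) refl G {D} (¬U53 ∘ isomorphicᵇ-sound U53 (represents-fromTriangle G))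
    3≤n n≤6 connected ¬tree diam
lemma3p1 6 G D 3≤n n≤6 (connected , ¬tree , _) ¬U64 _ diam =
  bounds-by-exhaustion (isomorphicᵇ U64) refl G {D} (¬U64 ∘ isomorphicᵇ-sound U64 (represents-fromTriangle G))
    3≤n n≤6 connected ¬tree diam
lemma3p1 (suc (suc (suc (suc (suc (suc (suc _))))))) G D _ (s≤s (s≤s (s≤s (s≤s (s≤s (s≤s ()))))))
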